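{- Let $\omega\in S_n$. The poset $M_\omega$ has a $B_2$-pattern if and only if it has a parallelogram-pattern.
   Context: Permutations are in one-line notation. ${\rm Inv}(\omega)=\{(i,j): 1\le i<j\le n,\ \omega(i)>\omega(j)\}$; $c_i(\omega)=\#\{j>i: \omega(i)>\omega(j)\}$; for $i<j$, $c_{i,j}(\omega)=\#\{k: i<k<j,\ \omega(i)>\omega(k)\}$; $[m]=\{1,\dots,m\}$. For $c_i(\omega)>0$ and $x\in[c_i(\omega)]$, $m_{i,x}(\omega)\in\mathbb{N}^n$ has $j$-th coordinate: $0$ if $(i,j)\in{\rm Inv}(\omega)$; $0$ if $j<i$; $x$ if $j=i$; $\max\{0,x-c_{i,j}(\omega)\}$ if $j>i$ and $(i,j)\notin{\rm Inv}(\omega)$. $M_\omega$ is the set of all $m_{i,x}(\omega)$, ordered componentwise. A $B_2$-pattern in a poset $P$ is a set of four distinct elements which, with the induced order, is isomorphic to the Boolean lattice $B_2$ of rank 2 (a minimum, a maximum, and two incomparable middle elements). For $1\le i<j\le n$, $b<a$ in $[c_i(\omega)]$, $c<d$ in $[c_j(\omega)]$ with $a+c=b+d$, the set $\{m_{i,a}(\omega),m_{i,b}(\omega),m_{j,c}(\omega),m_{j,d}(\omega)\}$ is a parallelogram-pattern poset if $m_{i,a}(\omega)>m_{j,d}(\omega)$, $m_{i,b}(\omega)>m_{j,c}(\omega)$, and $m_{i,b}(\omega)$, $m_{j,d}(\omega)$ are incomparable; $M_\omega$ has a parallelogram-pattern if it contains such a set. -}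

module Defs where

open import Data.Nat as ℕ using (ℕ; _∸_; _≤_)
open import Data.Fin as Fin using (Fin; toℕ)
open import Data.Fin.Permutation using (Permutation′; _⟨$⟩ʳ_)
open import Data.List using (List; length; filter; allFin)
open import Data.Vec using (Vec; tabulate; lookup)
open import Data.Product using (_×_; Σ; ∃; ∃-syntax; _,_)
open import Data.Bool using (Bool; true; false)
open import Relation.Nullary using (¬_; yes; no)
open import Relation.Nullary.Decidable using (_×-dec_)
open import Relation.Binary.PropositionalEquality using (_≡_; _≢_)

-- A permutation ω ∈ S_n, in one-line notation ω(1) … ω(n), is an element of
-- Permutation′ n (a bijection Fin n ↔ Fin n); positions and values are
-- 0-based (Fin n), which does not affect any comparisons below.

module _ {n : ℕ} (ω : Permutation′ n) where

  Inv : Fin n → Fin n → Set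
  Inv i j = (i Fin.< j) × (ω ⟨$⟩ʳ j Fin.< ω ⟨$⟩ʳ i)

  c : Fin n → ℕ
  c i = length (filter (λ j → (i Fin.<? j) ×-dec (ω ⟨$⟩ʳ j Fin.<? ω ⟨$⟩ʳ i)) (allFin n))

  cc : Fin n → Fin n → ℕ
  cc i j = length (filter (λ k → (i Fin.<? k) ×-dec ((k Fin.<? j) ×-dec (ω ⟨$⟩ʳ k Fin.<? ω ⟨$⟩ʳ i))) (allFin n))

  -- the vector m_{i,x}(ω) ∈ ℕ^n  (only meaningful for x ∈ [c_i(ω)])
  mcoord : Fin n → ℕ → Fin n → ℕ
  mcoord i x j with j Fin.<? i
  ... | yes _ = 0
  ... | no _ with i Fin.≟ j
  ...   | yes _ = x
  ...   | no _ with ω ⟨$⟩ʳ j Fin.<? ω ⟨$⟩ʳ i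
  ...     | yes _ = 0
  ...     | no _ = x ∸ cc i j  -- j > i and (i , j) ∉ Inv(ω): max{0, x - c_{i,j}}

  m : Fin n → ℕ → Vec ℕ n
  m i x = tabulate (mcoord i x)

  InRange : Fin n → ℕ → Set
  InRange i x = (1 ≤ x) × (x ≤ c i)

  InM : Vec ℕ n → Set
  InM v = ∃[ i ] ∃[ x ] (InRange i x × m i x ≡ v)

_≼_ : {n : ℕ} → Vec ℕ n → Vec ℕ n → Set
u ≼ v = ∀ k → lookup u k ≤ lookup v k

_≺_ : {n : ℕ} → Vec ℕ n → Vec ℕ n → Set
u ≺ v = (u ≼ v) × (u ≢ v)

Incomparable : {n : ℕ} → Vec ℕ n → Vec ℕ n → Set
Incomparable u v = ¬ (u ≼ v) × ¬ (v ≼ u)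

-- The Boolean lattice B_2 = Bool × Bool with the componentwise order (false < true)
data _≤B_ : Bool → Bool → Set where
  f≤b : ∀ {b} → false ≤B b
  t≤t : true ≤B true

_≤B₂_ : Bool × Bool → Bool × Bool → Set
(a , b) ≤B₂ (c , d) = (a ≤B c) × (b ≤B d)

-- B_2-pattern in M_ω: four distinct elements of M_ω whose induced order is
-- isomorphic to B_2, i.e. an injective map f : B_2 → M_ω that is an order
-- embedding (p ≤ q in B_2 iff f p ≼ f q).
HasB₂Pattern : {n : ℕ} → Permutation′ n → Set
HasB₂Pattern {n} ω =
  Σ (Bool × Bool → Vec ℕ n) λ f →
    (∀ p → InM ω (f p))
    × (∀ p q → f p ≡ f q → p ≡ q)
    × (∀ p q → (p ≤B₂ q → f p ≼ f q) × (f p ≼ f q → p ≤B₂ q))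

HasParallelogramPattern : {n : ℕ} → Permutation′ n → Set
HasParallelogramPattern {n} ω =
  ∃[ i ] ∃[ j ] ∃[ a ] ∃[ b ] ∃[ c' ] ∃[ d ]
    ( (i Fin.< j)
    × InRange ω i a × InRange ω i b × (b ℕ.< a)
    × InRange ω j c' × InRange ω j d × (c' ℕ.< d)
    × (a ℕ.+ c' ≡ b ℕ.+ d)
    × (m ω j d ≺ m ω i a)
    × (m ω j c' ≺ m ω i b)
    × Incomparable (m ω i b) (m ω j d) )

-- An element m_{j,y} of M_ω lies below m_{i,x} exactly when it is in the same row (j = i, y ≤ x)
-- or in a later row j > i with (i , j) ∉ Inv(ω) and y + c_{i,j} ≤ x.  Hence a non-inversion i < j
-- with c_j ≥ 2 and c_i ≥ c_{i,j} + 2 yields the parallelogram with corners m_{j,1}, m_{i,c_{i,j}+1},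
-- m_{j,2}, m_{i,c_{i,j}+2}.  Conversely, a middle element of a B₂-pattern that does not supply such
-- a pair lies in the row of the top or at level 1 in a later row.  The bottom then lies in a row after
-- both middles, and comparing c_{r,s} with c_{r,q} shows that the middle in the later row lies below
-- the other one, contradicting their incomparability.
module Submission where

open import Defs
open import Data.Nat using (ℕ)
open import Data.Fin.Permutation using (Permutation′)
open import Function.Bundles using (_⇔_)

open import Data.Bool using (Bool; true; false)
open import Data.Empty using (⊥; ⊥-elim)
open import Data.Fin as Fin using (Fin)
import Data.Fin.Properties as Fin
open import Data.Fin.Permutation using (_⟨$⟩ʳ_)
open import Data.List using (List; []; _∷_; length; filter; allFin)
open import Data.List.Membership.Propositional.Properties using (∈-allFin; ∈-filter⁺; ∈-length)
open import Data.List.Relation.Binary.Sublist.Propositional using (⊆-refl)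
open import Data.List.Relation.Binary.Sublist.Propositional.Properties using (filter⁺)
open import Data.List.Relation.Binary.Sublist.Heterogeneous.Properties using (length-mono-≤)
open import Data.Nat as ℕ using (zero; suc; _+_; _∸_; _≤_; _<_; z≤n; s≤s)
import Data.Nat.Properties as ℕ
open import Data.Product using (_×_; _,_; proj₁; proj₂)
open import Data.Sum using (_⊎_; inj₁; inj₂)
open import Data.Vec using (Vec)
open import Data.Vec.Properties using (lookup∘tabulate)
open import Function.Bundles using (mk⇔)
open import Level using (0ℓ)
open import Relation.Binary using (tri<; tri≈; tri>)
open import Relation.Binary.PropositionalEquality using (_≡_; _≢_; refl; sym; cong; cong₂; subst; subst₂)
open import Relation.Nullary using (¬_; yes; no)
open import Relation.Nullary.Decidable using (_×-dec_)
open import Relation.Unary using (Pred; Decidable; _∪_)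
open import Relation.Unary.Properties using (_∪?_)

length-filter-∪ : ∀ {a p q} {A : Set a} {P : Pred A p} {Q : Pred A q}
  (P? : Decidable P) (Q? : Decidable Q) (xs : List A) →
  length (filter (P? ∪? Q?) xs) ≤ length (filter P? xs) + length (filter Q? xs)
length-filter-∪ P? Q? [] = z≤n
length-filter-∪ P? Q? (x ∷ xs) with ih ← length-filter-∪ P? Q? xs | P? x | Q? x
... | yes _ | yes _ = s≤s (ℕ.≤-trans ih (ℕ.+-monoʳ-≤ _ (ℕ.n≤1+n _)))
... | yes _ | no  _ = s≤s ih
... | no  _ | yes _ = ℕ.≤-trans (s≤s ih) (ℕ.≤-reflexive (sym (ℕ.+-suc _ _)))
... | no  _ | no  _ = ih

positive-≤∸⇒+≤ : ∀ {x c y} → 1 ≤ y → y ≤ x ∸ c → y + c ≤ x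
positive-≤∸⇒+≤ {x} {c} {y} y≥1 y≤x∸c = ℕ.m≤o∸n⇒m+n≤o y (ℕ.<⇒≤ (ℕ.m∸n≢0⇒n<m x∸c≢0)) y≤x∸c
  where
    x∸c≢0 : x ∸ c ≢ 0
    x∸c≢0 eq = ℕ.<⇒≱ y≥1 (subst (y ≤_) eq y≤x∸c)

one-or-≥2 : ∀ {u} → 1 ≤ u → u ≡ 1 ⊎ 2 ≤ u
one-or-≥2 (s≤s {n = zero} z≤n)  = inj₁ refl
one-or-≥2 (s≤s {n = suc _} z≤n) = inj₂ (s≤s (s≤s z≤n))

≼-refl : ∀ {n} (u : Vec ℕ n) → u ≼ u
≼-refl u k = ℕ.≤-refl

≼-trans : ∀ {n} (u v w : Vec ℕ n) → u ≼ v → v ≼ w → u ≼ w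
≼-trans u v w u≼v v≼w k = ℕ.≤-trans (u≼v k) (v≼w k)

≤B-antisym : ∀ {a b} → a ≤B b → b ≤B a → a ≡ b
≤B-antisym f≤b f≤b = refl
≤B-antisym t≤t t≤t = refl

≤B₂-antisym : ∀ {p q} → p ≤B₂ q → q ≤B₂ p → p ≡ q
≤B₂-antisym (a≤c , b≤d) (c≤a , d≤b) = cong₂ _,_ (≤B-antisym a≤c c≤a) (≤B-antisym b≤d d≤b)

-- Distinctness of the four corners is not a field: it follows from the incomparability of the middle ones.
record Square {n} (bot left right top : Vec ℕ n) : Set where
  field
    bot≼left   : bot ≼ left
    bot≼right  : bot ≼ right
    left≼top   : left ≼ top
    right≼top  : right ≼ top
    left⋠right : ¬ left ≼ right
    right⋠left : ¬ right ≼ left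

  swap : Square bot right left top
  swap = record
    { bot≼left = bot≼right ; bot≼right = bot≼left
    ; left≼top = right≼top ; right≼top = left≼top
    ; left⋠right = right⋠left ; right⋠left = left⋠right
    }

  bot≢left : bot ≢ left
  bot≢left refl = left⋠right bot≼right

  bot≢right : bot ≢ right
  bot≢right refl = right⋠left bot≼left

  right≢top : right ≢ top
  right≢top refl = left⋠right left≼top

  corner : Bool × Bool → Vec ℕ n
  corner (false , false) = bot
  corner (true  , false) = left
  corner (false , true)  = right
  corner (true  , true)  = top

  corner-mono : ∀ p q → p ≤B₂ q → corner p ≼ corner q
  corner-mono (false , false) (false , false) _ = ≼-refl bot
  corner-mono (false , false) (true  , false) _ = bot≼left
  corner-mono (false , false) (false , true)  _ = bot≼right
  corner-mono (false , false) (true  , true)  _ = ≼-trans bot left top bot≼left left≼top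
  corner-mono (true  , false) (true  , false) _ = ≼-refl left
  corner-mono (true  , false) (true  , true)  _ = left≼top
  corner-mono (false , true)  (false , true)  _ = ≼-refl right
  corner-mono (false , true)  (true  , true)  _ = right≼top
  corner-mono (true  , true)  (true  , true)  _ = ≼-refl top
  corner-mono (true  , _) (false , _) (() , _)
  corner-mono (_ , true)  (_ , false) (_ , ())

  corner-reflect : ∀ p q → corner p ≼ corner q → p ≤B₂ q
  corner-reflect (false , false) _ _ = f≤b , f≤b
  corner-reflect (true  , false) (true , _) _ = t≤t , f≤b
  corner-reflect (false , true)  (_ , true) _ = f≤b , t≤t
  corner-reflect (true  , true)  (true , true) _ = t≤t , t≤t
  corner-reflect (true  , false) (false , true)  le = ⊥-elim (left⋠right le)
  corner-reflect (true  , false) (false , false) le = ⊥-elim (left⋠right (≼-trans left bot right le bot≼right))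
  corner-reflect (false , true)  (true  , false) le = ⊥-elim (right⋠left le)
  corner-reflect (false , true)  (false , false) le = ⊥-elim (right⋠left (≼-trans right bot left le bot≼left))
  corner-reflect (true  , true)  (true  , false) le = ⊥-elim (right⋠left (≼-trans right top left right≼top le))
  corner-reflect (true  , true)  (false , true)  le = ⊥-elim (left⋠right (≼-trans left top right left≼top le))
  corner-reflect (true  , true)  (false , false) le =
    ⊥-elim (left⋠right (≼-trans left top right left≼top (≼-trans top bot right le bot≼right)))

  corner-injective : ∀ p q → corner p ≡ corner q → p ≡ q
  corner-injective p q eq =
    ≤B₂-antisym (corner-reflect p q (subst (corner p ≼_) eq (≼-refl (corner p))))
                (corner-reflect q p (subst (_≼ corner p) eq (≼-refl (corner p))))

square-resp-≡ : ∀ {n} {b l r t b′ l′ r′ t′ : Vec ℕ n} →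
  b ≡ b′ → l ≡ l′ → r ≡ r′ → t ≡ t′ → Square b l r t → Square b′ l′ r′ t′
square-resp-≡ refl refl refl refl sq = sq

B₂-embedding⇒square : ∀ {n} (f : Bool × Bool → Vec ℕ n) →
  (∀ p q → (p ≤B₂ q → f p ≼ f q) × (f p ≼ f q → p ≤B₂ q)) →
  Square (f (false , false)) (f (true , false)) (f (false , true)) (f (true , true))
B₂-embedding⇒square f embed = record
  { bot≼left   = mono (false , false) (true , false) (f≤b , f≤b)
  ; bot≼right  = mono (false , false) (false , true) (f≤b , f≤b)
  ; left≼top   = mono (true , false) (true , true) (t≤t , f≤b)
  ; right≼top  = mono (false , true) (true , true) (f≤b , t≤t)
  ; left⋠right = λ le → true≰false (proj₁ (reflect (true , false) (false , true) le))
  ; right⋠left = λ le → true≰false (proj₂ (reflect (false , true) (true , false) le))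
  }
  where
    mono : ∀ p q → p ≤B₂ q → f p ≼ f q
    mono p q = proj₁ (embed p q)
    reflect : ∀ p q → f p ≼ f q → p ≤B₂ q
    reflect p q = proj₂ (embed p q)
    true≰false : ¬ true ≤B false
    true≰false ()

module _ {n : ℕ} (ω : Permutation′ n) where

  private
    π : Fin n → Fin n
    π = ω ⟨$⟩ʳ_

  Between : Fin n → Fin n → Pred (Fin n) 0ℓ
  Between i j k = i Fin.< k × k Fin.< j × π k Fin.< π i

  between? : (i j : Fin n) → Decidable (Between i j)
  between? i j k = (i Fin.<? k) ×-dec ((k Fin.<? j) ×-dec (π k Fin.<? π i))

  cc-mono : ∀ {i j k} → j Fin.< k → cc ω i j ≤ cc ω i k
  cc-mono {i} {j} {k} j<k =
    length-mono-≤ (filter⁺ (between? i j) (between? i k) widen (⊆-refl {x = allFin n}))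
    where
      widen : ∀ {l l′} → l ≡ l′ → Between i j l → Between i k l′
      widen refl (i<l , l<j , πl<πi) = i<l , Fin.<-trans l<j j<k , πl<πi

  cc-pos : ∀ {i j k} → i Fin.< j → j Fin.< k → π j Fin.< π i → 1 ≤ cc ω i k
  cc-pos {i} {j} {k} i<j j<k πj<πi = ∈-length (∈-filter⁺ (between? i k) (∈-allFin j) (i<j , j<k , πj<πi))

  cc-triangle : ∀ {i j k} → i Fin.< j → ¬ π j Fin.< π i → cc ω i k ≤ cc ω i j + cc ω j k
  cc-triangle {i} {j} {k} i<j πj≮πi = ℕ.≤-trans
    (length-mono-≤ (filter⁺ (between? i k) (between? i j ∪? between? j k) split (⊆-refl {x = allFin n})))
    (length-filter-∪ (between? i j) (between? j k) (allFin n))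
    where
      split : ∀ {l l′} → l ≡ l′ → Between i k l → (Between i j ∪ Between j k) l′
      split {l} refl (i<l , l<k , πl<πi) with Fin.<-cmp l j
      ... | tri< l<j _ _ = inj₁ (i<l , l<j , πl<πi)
      ... | tri≈ _ refl _ = ⊥-elim (πj≮πi πl<πi)
      ... | tri> _ _ j<l = inj₂ (j<l , l<k , ℕ.<-≤-trans πl<πi (ℕ.≮⇒≥ πj≮πi))

  mcoord-before : ∀ i x {k} → k Fin.< i → mcoord ω i x k ≡ 0
  mcoord-before i x {k} k<i with k Fin.<? i
  ... | yes _   = refl
  ... | no  k≮i = ⊥-elim (k≮i k<i)

  mcoord-self : ∀ i x → mcoord ω i x i ≡ x
  mcoord-self i x with i Fin.<? i
  ... | yes i<i = ⊥-elim (Fin.<-irrefl refl i<i)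
  ... | no _ with i Fin.≟ i
  ...   | yes _ = refl
  ...   | no i≢i = ⊥-elim (i≢i refl)

  mcoord-inversion : ∀ i x {k} → i Fin.< k → π k Fin.< π i → mcoord ω i x k ≡ 0
  mcoord-inversion i x {k} i<k πk<πi with k Fin.<? i
  ... | yes _ = refl
  ... | no _ with i Fin.≟ k
  ...   | yes refl = ⊥-elim (Fin.<-irrefl refl i<k)
  ...   | no _ with π k Fin.<? π i
  ...     | yes _ = refl
  ...     | no πk≮πi = ⊥-elim (πk≮πi πk<πi)

  mcoord-noninversion : ∀ i x {k} → i Fin.< k → ¬ π k Fin.< π i → mcoord ω i x k ≡ x ∸ cc ω i k
  mcoord-noninversion i x {k} i<k πk≮πi with k Fin.<? i
  ... | yes k<i = ⊥-elim (Fin.<-asym i<k k<i)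
  ... | no _ with i Fin.≟ k
  ...   | yes refl = ⊥-elim (Fin.<-irrefl refl i<k)
  ...   | no _ with π k Fin.<? π i
  ...     | yes πk<πi = ⊥-elim (πk≮πi πk<πi)
  ...     | no _ = refl

  mcoord-mono : ∀ i {x y} k → x ≤ y → mcoord ω i x k ≤ mcoord ω i y k
  mcoord-mono i k x≤y with k Fin.<? i
  ... | yes _ = z≤n
  ... | no _ with i Fin.≟ k
  ...   | yes _ = x≤y
  ...   | no _ with π k Fin.<? π i
  ...     | yes _ = z≤n
  ...     | no _ = ℕ.∸-monoˡ-≤ (cc ω i k) x≤y

  ≼⇒mcoord≤ : ∀ {i x j y} → m ω i x ≼ m ω j y → ∀ k → mcoord ω i x k ≤ mcoord ω j y k
  ≼⇒mcoord≤ {i} {x} {j} {y} le k =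
    subst₂ _≤_ (lookup∘tabulate (mcoord ω i x) k) (lookup∘tabulate (mcoord ω j y) k) (le k)

  mcoord≤⇒≼ : ∀ {i x j y} → (∀ k → mcoord ω i x k ≤ mcoord ω j y k) → m ω i x ≼ m ω j y
  mcoord≤⇒≼ {i} {x} {j} {y} le k =
    subst₂ _≤_ (sym (lookup∘tabulate (mcoord ω i x) k)) (sym (lookup∘tabulate (mcoord ω j y) k)) (le k)

  ≼⇒level≤ : ∀ {i x j y} → m ω j y ≼ m ω i x → y ≤ mcoord ω i x j
  ≼⇒level≤ {i} {x} {j} {y} le =
    subst (_≤ mcoord ω i x j) (mcoord-self j y) (≼⇒mcoord≤ {j} {y} {i} {x} le j)

  infix 4 _⊑_
  data _⊑_ : Fin n × ℕ → Fin n × ℕ → Set where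
    same-row  : ∀ {i x y} → y ≤ x → (i , y) ⊑ (i , x)
    later-row : ∀ {i j x y} → i Fin.< j → ¬ π j Fin.< π i → y + cc ω i j ≤ x → (j , y) ⊑ (i , x)

  ⊑⇒≼ : ∀ {i x j y} → (j , y) ⊑ (i , x) → m ω j y ≼ m ω i x
  ⊑⇒≼ {i} {x} {.i} {y} (same-row y≤x) = mcoord≤⇒≼ {i} {y} {i} {x} (λ k → mcoord-mono i k y≤x)
  ⊑⇒≼ {i} {x} {j} {y} (later-row i<j πj≮πi y+c≤x) = mcoord≤⇒≼ {j} {y} {i} {x} bound
    where
      y≤x∸c : y ≤ x ∸ cc ω i j
      y≤x∸c = ℕ.m+n≤o⇒m≤o∸n y y+c≤x
      bound : ∀ k → mcoord ω j y k ≤ mcoord ω i x k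
      bound k with Fin.<-cmp k j
      ... | tri< k<j _ _ = ℕ.≤-trans (ℕ.≤-reflexive (mcoord-before j y k<j)) z≤n
      ... | tri≈ _ refl _ =
        subst₂ _≤_ (sym (mcoord-self j y)) (sym (mcoord-noninversion i x i<j πj≮πi)) y≤x∸c
      ... | tri> _ _ j<k with π k Fin.<? π j
      ...   | yes πk<πj = ℕ.≤-trans (ℕ.≤-reflexive (mcoord-inversion j y j<k πk<πj)) z≤n
      ...   | no πk≮πj = begin
        mcoord ω j y k              ≡⟨ mcoord-noninversion j y j<k πk≮πj ⟩
        y ∸ cc ω j k                ≤⟨ ℕ.∸-monoˡ-≤ (cc ω j k) y≤x∸c ⟩
        x ∸ cc ω i j ∸ cc ω j k     ≡⟨ ℕ.∸-+-assoc x (cc ω i j) (cc ω j k) ⟩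
        x ∸ (cc ω i j + cc ω j k)   ≤⟨ ℕ.∸-monoʳ-≤ x (cc-triangle i<j πj≮πi) ⟩
        x ∸ cc ω i k                ≡⟨ mcoord-noninversion i x (Fin.<-trans i<j j<k) πk≮πi ⟨
        mcoord ω i x k              ∎
        where
          open ℕ.≤-Reasoning
          πk≮πi : ¬ π k Fin.< π i
          πk≮πi = ℕ.≤⇒≯ (ℕ.≤-trans (ℕ.≮⇒≥ πj≮πi) (ℕ.≮⇒≥ πk≮πj))

  ≼⇒⊑ : ∀ {i x j y} → 1 ≤ y → m ω j y ≼ m ω i x → (j , y) ⊑ (i , x)
  ≼⇒⊑ {i} {x} {j} {y} y≥1 le with ≼⇒level≤ {i} {x} {j} {y} le | Fin.<-cmp i j
  ... | level | tri≈ _ refl _ = same-row (subst (y ≤_) (mcoord-self i x) level)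
  ... | level | tri> _ _ j<i = ⊥-elim (ℕ.<⇒≱ y≥1 (subst (y ≤_) (mcoord-before i x j<i) level))
  ... | level | tri< i<j _ _ with π j Fin.<? π i
  ...   | yes πj<πi = ⊥-elim (ℕ.<⇒≱ y≥1 (subst (y ≤_) (mcoord-inversion i x i<j πj<πi) level))
  ...   | no πj≮πi =
    later-row i<j πj≮πi (positive-≤∸⇒+≤ y≥1 (subst (y ≤_) (mcoord-noninversion i x i<j πj≮πi) level))

  ⊑-later : ∀ {i x j y} → i Fin.< j → (j , y) ⊑ (i , x) → ¬ π j Fin.< π i × y + cc ω i j ≤ x
  ⊑-later i<i (same-row _) = ⊥-elim (Fin.<-irrefl refl i<i)
  ⊑-later _ (later-row _ πj≮πi y+d≤x) = πj≮πi , y+d≤x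

  earlier-row-⋠ : ∀ {i x j y} → i Fin.< j → 1 ≤ x → ¬ m ω i x ≼ m ω j y
  earlier-row-⋠ {i} {x} {j} {y} i<j x≥1 le with ≼⇒⊑ {j} {y} {i} {x} x≥1 le
  ... | same-row _ = Fin.<-irrefl refl i<j
  ... | later-row j<i _ _ = Fin.<-asym i<j j<i

  record ParallelogramPair : Set where
    field
      i j    : Fin n
      i<j    : i Fin.< j
      πj≮πi  : ¬ π j Fin.< π i
      room-i : 2 + cc ω i j ≤ c ω i
      room-j : 2 ≤ c ω j

  parallelogram-pair⇒pattern : ParallelogramPair → HasParallelogramPattern ω
  parallelogram-pair⇒pattern pair =
    i , j , 2 + d , 1 + d , 1 , 2 , i<j ,
    (s≤s z≤n , room-i) , (s≤s z≤n , ℕ.≤-trans (ℕ.n≤1+n _) room-i) , ℕ.≤-refl ,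
    (ℕ.≤-refl , ℕ.≤-trans (ℕ.n≤1+n 1) room-j) , (s≤s z≤n , room-j) , ℕ.≤-refl ,
    cong suc (sym (ℕ.+-suc d 1)) ,
    (right≼top , right≢top) , (bot≼left , bot≢left) , (left⋠right , right⋠left)
    where
      open ParallelogramPair pair
      d : ℕ
      d = cc ω i j
      sq : Square (m ω j 1) (m ω i (1 + d)) (m ω j 2) (m ω i (2 + d))
      sq = record
        { bot≼left   = ⊑⇒≼ {i} {1 + d} {j} {1} (later-row i<j πj≮πi ℕ.≤-refl)
        ; bot≼right  = ⊑⇒≼ {j} {2} {j} {1} (same-row (s≤s z≤n))
        ; left≼top   = ⊑⇒≼ {i} {2 + d} {i} {1 + d} (same-row (ℕ.n≤1+n _))
        ; right≼top  = ⊑⇒≼ {i} {2 + d} {j} {2} (later-row i<j πj≮πi ℕ.≤-refl)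
        ; left⋠right = earlier-row-⋠ {i} {1 + d} {j} {2} i<j (s≤s z≤n)
        ; right⋠left = λ le → ℕ.<-irrefl refl (proj₂ (⊑-later i<j (≼⇒⊑ {i} {1 + d} {j} {2} (s≤s z≤n) le)))
        }
      open Square sq

  cell : Fin n × ℕ → Vec ℕ n
  cell (i , x) = m ω i x

  record CellSquare (bot left right top : Fin n × ℕ) : Set where
    field
      square : Square (cell bot) (cell left) (cell right) (cell top)

    open Square square public
      using (bot≼left; bot≼right; left≼top; right≼top; left⋠right; right⋠left; bot≢right)

    swap : CellSquare bot right left top
    swap = record { square = Square.swap square }

  data MiddleShape (p : Fin n) : Fin n × ℕ → Set where
    top-row    : ∀ {y} → MiddleShape p (p , y)
    unit-later : ∀ {t} → p Fin.< t → ¬ π t Fin.< π p → MiddleShape p (t , 1)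

  middle-shape : ∀ {p x t u} → InRange ω p x → InRange ω t u → m ω t u ≼ m ω p x →
    ParallelogramPair ⊎ MiddleShape p (t , u)
  middle-shape {p} {x} {t} {u} (_ , x≤c) (u≥1 , u≤c) le with ≼⇒⊑ {p} {x} {t} {u} u≥1 le
  ... | same-row _ = inj₂ top-row
  ... | later-row p<t πt≮πp u+d≤x with one-or-≥2 u≥1
  ...   | inj₁ refl = inj₂ (unit-later p<t πt≮πp)
  ...   | inj₂ u≥2 = inj₁ record
    { i = p ; j = t ; i<j = p<t ; πj≮πi = πt≮πp
    ; room-i = ℕ.≤-trans (ℕ.+-monoˡ-≤ (cc ω p t) u≥2) (ℕ.≤-trans u+d≤x x≤c)
    ; room-j = ℕ.≤-trans u≥2 u≤c
    }

  row-middles-absurd : ∀ {bot top p y z} → ¬ CellSquare bot (p , y) (p , z) top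
  row-middles-absurd {p = p} {y} {z} sq with ℕ.≤-total y z
  ... | inj₁ y≤z = CellSquare.left⋠right sq (⊑⇒≼ {p} {z} {p} {y} (same-row y≤z))
  ... | inj₂ z≤y = CellSquare.right⋠left sq (⊑⇒≼ {p} {y} {p} {z} (same-row z≤y))

  bottom-below-left : ∀ {q w r y s top} → r Fin.< s → 1 ≤ w →
    CellSquare (q , w) (r , y) (s , 1) top → s Fin.< q × w + cc ω r q ≤ y
  bottom-below-left {q} {w} {r} {y} {s} r<s w≥1 sq
    with ≼⇒⊑ {s} {1} {q} {w} w≥1 (CellSquare.bot≼right sq)
  ... | same-row w≤1 with ℕ.≤-antisym w≤1 w≥1
  ...   | refl = ⊥-elim (CellSquare.bot≢right sq refl)
  bottom-below-left {q} {w} {r} {y} {s} r<s w≥1 sq | later-row s<q _ _ =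
    s<q , proj₂ (⊑-later (Fin.<-trans r<s s<q) (≼⇒⊑ {r} {y} {q} {w} w≥1 (CellSquare.bot≼left sq)))

  unit-right-absurd : ∀ {q w r y s top} → r Fin.< s → ¬ π s Fin.< π r → 1 ≤ w →
    ¬ CellSquare (q , w) (r , y) (s , 1) top
  unit-right-absurd {q} {w} {r} {y} {s} r<s πs≮πr w≥1 sq =
    CellSquare.right⋠left sq (⊑⇒≼ {r} {y} {s} {1} (later-row r<s πs≮πr 1+d≤y))
    where
      open ℕ.≤-Reasoning
      below : s Fin.< q × w + cc ω r q ≤ y
      below = bottom-below-left r<s w≥1 sq
      1+d≤y : 1 + cc ω r s ≤ y
      1+d≤y = begin
        1 + cc ω r s  ≤⟨ ℕ.+-mono-≤ w≥1 (cc-mono (proj₁ below)) ⟩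
        w + cc ω r q  ≤⟨ proj₂ below ⟩
        y             ∎

  unit-pair-absurd : ∀ {q w r s top} → r Fin.< s → 1 ≤ w → ¬ CellSquare (q , w) (r , 1) (s , 1) top
  unit-pair-absurd {q} {w} {r} {s} r<s w≥1 sq with π s Fin.<? π r
  ... | no πs≮πr = unit-right-absurd r<s πs≮πr w≥1 sq
  ... | yes πs<πr = ℕ.<-irrefl refl (ℕ.≤-trans 2≤w+d (proj₂ below))
    where
      below : s Fin.< q × w + cc ω r q ≤ 1
      below = bottom-below-left r<s w≥1 sq
      2≤w+d : 2 ≤ w + cc ω r q
      2≤w+d = ℕ.+-mono-≤ w≥1 (cc-pos r<s (proj₁ below) πs<πr)

  units-absurd : ∀ {q w r s top} → 1 ≤ w → ¬ CellSquare (q , w) (r , 1) (s , 1) top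
  units-absurd {r = r} {s} w≥1 sq with Fin.<-cmp r s
  ... | tri< r<s _ _ = unit-pair-absurd r<s w≥1 sq
  ... | tri≈ _ refl _ = CellSquare.left⋠right sq (≼-refl (m ω r 1))
  ... | tri> _ _ s<r = unit-pair-absurd s<r w≥1 (CellSquare.swap sq)

  square⇒parallelogram-pair : ∀ {q w r y s z p x} →
    InRange ω q w → InRange ω r y → InRange ω s z → InRange ω p x →
    CellSquare (q , w) (r , y) (s , z) (p , x) → ParallelogramPair
  square⇒parallelogram-pair (w≥1 , _) r∈ s∈ p∈ sq
    with middle-shape p∈ r∈ (CellSquare.left≼top sq) | middle-shape p∈ s∈ (CellSquare.right≼top sq)
  ... | inj₁ pair | _ = pair
  ... | inj₂ _ | inj₁ pair = pair
  ... | inj₂ top-row | inj₂ top-row = ⊥-elim (row-middles-absurd sq)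
  ... | inj₂ top-row | inj₂ (unit-later p<s πs≮πp) = ⊥-elim (unit-right-absurd p<s πs≮πp w≥1 sq)
  ... | inj₂ (unit-later p<r πr≮πp) | inj₂ top-row =
    ⊥-elim (unit-right-absurd p<r πr≮πp w≥1 (CellSquare.swap sq))
  ... | inj₂ (unit-later _ _) | inj₂ (unit-later _ _) = ⊥-elim (units-absurd w≥1 sq)

  B₂-pattern⇒parallelogram-pair : HasB₂Pattern ω → ParallelogramPair
  B₂-pattern⇒parallelogram-pair (f , f∈M , _ , embed)
    with f∈M (false , false) | f∈M (true , false) | f∈M (false , true) | f∈M (true , true)
  ... | q , w , q∈ , bot≡ | r , y , r∈ , left≡ | s , z , s∈ , right≡ | p , x , p∈ , top≡ =
    square⇒parallelogram-pair q∈ r∈ s∈ p∈ (record { square = cell-square })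
    where
      cell-square : Square (m ω q w) (m ω r y) (m ω s z) (m ω p x)
      cell-square =
        square-resp-≡ (sym bot≡) (sym left≡) (sym right≡) (sym top≡) (B₂-embedding⇒square f embed)

  square⇒B₂-pattern : ∀ {bot left right top} → InM ω bot → InM ω left → InM ω right → InM ω top →
    Square bot left right top → HasB₂Pattern ω
  square⇒B₂-pattern bot∈ left∈ right∈ top∈ sq =
    corner , corner∈M , corner-injective , λ p q → corner-mono p q , corner-reflect p q
    where
      open Square sq
      corner∈M : ∀ p → InM ω (corner p)
      corner∈M (false , false) = bot∈
      corner∈M (true  , false) = left∈
      corner∈M (false , true)  = right∈
      corner∈M (true  , true)  = top∈

  parallelogram⇒B₂-pattern : HasParallelogramPattern ω → HasB₂Pattern ω
  parallelogram⇒B₂-pattern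
    (i , j , a , b , c′ , d , _ , a∈ , b∈ , b<a , c∈ , d∈ , c<d , _ , (d≼a , _) , (c≼b , _) , (b⋠d , d⋠b)) =
    square⇒B₂-pattern (j , c′ , c∈ , refl) (i , b , b∈ , refl) (j , d , d∈ , refl) (i , a , a∈ , refl) record
      { bot≼left   = c≼b
      ; bot≼right  = ⊑⇒≼ {j} {d} {j} {c′} (same-row (ℕ.<⇒≤ c<d))
      ; left≼top   = ⊑⇒≼ {i} {a} {i} {b} (same-row (ℕ.<⇒≤ b<a))
      ; right≼top  = d≼a
      ; left⋠right = b⋠d
      ; right⋠left = d⋠b
      }

mainTheorem7 : (n : ℕ) (ω : Permutation′ n) → HasB₂Pattern ω ⇔ HasParallelogramPattern ω
mainTheorem7 n ω = mk⇔
  (λ b₂ → parallelogram-pair⇒pattern ω (B₂-pattern⇒parallelogram-pair ω b₂))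
  (parallelogram⇒B₂-pattern ω)
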